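{- Let $p$ be an odd prime, $q$ a power of $p$, $l\ge 0$ an integer, $n=p^l+1$, and $k$ an integer with $0\le k\le p-1$ and $k\neq 0,2$. Then $D_{n,k}(1,x)$ is a permutation polynomial of $\mathbb{F}_q$ if and only if $l=0$.
   Context: For an integer $n\ge1$, $D_{n,k}(1,x)=\sum_{i=0}^{\lfloor n/2\rfloor}\frac{n-ki}{n-i}\binom{n-i}{i}(-x)^i\in\mathbb{F}_q[x]$ (the coefficients are integers, reduced mod $p$). A permutation polynomial of $\mathbb{F}_q$ is a polynomial inducing a bijection of $\mathbb{F}_q$. -}

module Defs where

open import Level using (Level; _⊔_)
open import Data.Nat as ℕ using (ℕ; zero; suc; _∸_; _≤_)
open import Data.Nat.Combinatorics using (_C_)
open import Data.Integer as ℤ using (ℤ; +_; -[1+_])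
open import Data.Integer.DivMod using (_/ℕ_)
open import Data.Fin using (Fin)
open import Data.List using (List; foldr; map; upTo)
open import Data.Product using (Σ; _×_; ∃)
open import Relation.Nullary using (¬_)
open import Relation.Binary.PropositionalEquality using (_≡_)
open import Algebra.Bundles using (CommutativeRing)

record FiniteField (c ℓ : Level) (q : ℕ) : Set (Level.suc (c ⊔ ℓ)) where
  field
    cring     : CommutativeRing c ℓ
  open CommutativeRing cring public
  field
    0≉1       : ¬ (0# ≈ 1#)
    inverse   : ∀ x → ¬ (x ≈ 0#) → ∃ λ y → x * y ≈ 1#
    enum      : Fin q → Carrier
    enum-inj  : ∀ i j → enum i ≈ enum j → i ≡ j
    enum-surj : ∀ x → ∃ λ i → enum i ≈ x

-- Division of an integer by a natural number (used only where it is exact);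
-- division by 0 is set to 0 (never used below since n - i ≥ 1).
_÷_ : ℤ → ℕ → ℤ
a ÷ zero  = + 0
a ÷ suc m = a /ℕ suc m

Dcoef : ℕ → ℕ → ℕ → ℤ
Dcoef n k i = ((ℤ.+ n ℤ.- ℤ.+ (k ℕ.* i)) ℤ.* ℤ.+ ((n ∸ i) C i)) ÷ (n ∸ i)

module _ {c ℓ : Level} {q : ℕ} (F : FiniteField c ℓ q) where
  open FiniteField F

  ℕ→F : ℕ → Carrier
  ℕ→F zero    = 0#
  ℕ→F (suc m) = 1# + ℕ→F m

  ℤ→F : ℤ → Carrier
  ℤ→F (+ m)      = ℕ→F m
  ℤ→F -[1+ m ]   = - ℕ→F (suc m)

  pow : Carrier → ℕ → Carrier
  pow x zero    = 1#
  pow x (suc m) = x * pow x m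

  -- Evaluation of D_{n,k}(1,x) = Σ_{i=0}^{⌊n/2⌋} (n-ki)/(n-i) C(n-i,i) (-x)^i
  D : ℕ → ℕ → Carrier → Carrier
  D n k x = foldr _+_ 0#
              (map (λ i → ℤ→F (Dcoef n k i) * pow (- x) i) (upTo (suc (n ℕ./ 2))))

  IsPermutation : (Carrier → Carrier) → Set (c ⊔ ℓ)
  IsPermutation f = (∀ x y → f x ≈ f y → x ≈ y) × (∀ y → ∃ λ x → f x ≈ y)

-- Let E_j(x) = Σ_i C(j−i,i)(−x)^i be the Dickson polynomials of the second kind, so that
-- E_{j+2} = E_{j+1} − x E_j.  Splitting (n−ki)/(n−i)·C(n−i,i) = C(n−i,i) − (k−1)·C(n−i−1,i−1)
-- gives D_{n,k} = E_n + (k−1) x E_{n−2}.  For n = 2 this is 1 − (2−k)x, a permutation as k ≠ 2.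
-- For n = p^l + 1 with l ≥ 1 put d = 1 − 4x and y = (1 + √d)/2 in F[√d].  Then y² = y − x, so
-- y^{j+2} = E_{j+1} y − x E_j, while the Frobenius gives y^{p^l} = (1 + d^{(p^l−1)/2} √d)/2.
-- Comparing √d-coefficients, D_{p^l+1,k}(x) = 1/2 + d^{(p^l−1)/2} (1/2 − (2−k)x), which equals
-- 1/2 both at x = 1/4 (where d = 0) and at x = 1/(2(2−k)); these points differ because k ≠ 0.

module Submission where

open import Level using (Level)
open import Algebra.Bundles using (AbelianGroup; CommutativeRing)
import Algebra.Construct.DirectProduct as DirectProduct
open import Algebra.Structures using (IsCommutativeRing)
import Algebra.Solver.Ring
open import Algebra.Solver.Ring.AlmostCommutativeRing using (fromCommutativeRing; _-Raw-AlmostCommutative⟶_)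
open import Data.Nat as ℕ using (ℕ; zero; suc; _∸_; _<_; _≤_; s≤s; z≤n)
import Data.Nat.Properties as ℕ
open import Data.Nat.Combinatorics using (_C_; nCk+nC[k+1]≡[n+1]C[k+1]; nC1≡n; nCn≡1; k>n⇒nCk≡0)
open import Data.Nat.Divisibility using (_∣_; divides)
open import Data.Nat.Primality using (Prime; prime⇒nonZero; prime⇒irreducible)
open import Data.Nat.Coprimality using (prime⇒coprime; coprime-divisor; coprime-Bézout)
open import Data.Nat.GCD using (module Bézout)
open import Data.Nat.DivMod using (_/_; _%_; m*n/n≡m; m*n%n≡0; m≡m%n+[m/n]*n; m%n<n; m/n≡1+[m∸n]/n; m/n≤m)
open import Data.Integer as ℤ using (ℤ; _⊖_; _◃_; sign; ∣_∣)
import Data.Integer.Properties as ℤ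
open import Data.Integer.DivMod using (_/ℕ_)
open import Data.Sign as Sign using (Sign)
open import Data.Fin as Fin using (Fin; inject₁; fromℕ)
import Data.Fin.Properties as Fin
open import Data.Fin.Permutation using (Permutation; permutation)
open import Data.List using (foldr; map; applyUpTo)
open import Data.Maybe using (Maybe; just; nothing)
open import Data.Product as Σ using (∃; _,_; proj₁; proj₂)
open import Data.Sum using (inj₁; inj₂)
open import Data.Empty using (⊥-elim)
open import Relation.Nullary using (¬_; yes; no; contradiction)
open import Relation.Binary.Definitions using (Decidable)
open import Relation.Binary.PropositionalEquality as ≡ using (_≡_; _≢_)
import Relation.Binary.Reasoning.Setoid
open import Function.Bundles using (_⇔_; mk⇔)
open import Data.Nat.Solver using (module +-*-Solver)
import Data.Integer.Solver
open import Defs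

[k+1]*[n+1]C[k+1]≡[n+1]*nCk : ∀ n k → suc k ℕ.* (suc n C suc k) ≡ suc n ℕ.* (n C k)
[k+1]*[n+1]C[k+1]≡[n+1]*nCk zero    zero    = ≡.refl
[k+1]*[n+1]C[k+1]≡[n+1]*nCk zero    (suc k) =
  ≡.trans (≡.cong (suc (suc k) ℕ.*_) (k>n⇒nCk≡0 {1} {suc (suc k)} (s≤s (s≤s z≤n)))) (ℕ.*-zeroʳ (suc (suc k)))
[k+1]*[n+1]C[k+1]≡[n+1]*nCk (suc n) zero    =
  ≡.trans (ℕ.*-identityˡ _) (≡.trans (nC1≡n (suc (suc n))) (≡.sym (ℕ.*-identityʳ (suc (suc n)))))
[k+1]*[n+1]C[k+1]≡[n+1]*nCk (suc n) (suc k) = begin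
  suc (suc k) ℕ.* (suc (suc n) C suc (suc k))
    ≡⟨ ≡.cong (suc (suc k) ℕ.*_) (nCk+nC[k+1]≡[n+1]C[k+1] (suc n) (suc k)) ⟨
  suc (suc k) ℕ.* (suc n C suc k ℕ.+ suc n C suc (suc k))
    ≡⟨ solve 3 (λ k a b → (con 2 :+ k) :* (a :+ b) := (con 1 :+ k) :* a :+ a :+ (con 2 :+ k) :* b) ≡.refl k (suc n C suc k) (suc n C suc (suc k)) ⟩
  suc k ℕ.* (suc n C suc k) ℕ.+ suc n C suc k ℕ.+ suc (suc k) ℕ.* (suc n C suc (suc k))
    ≡⟨ ≡.cong₂ (λ a b → a ℕ.+ suc n C suc k ℕ.+ b) ([k+1]*[n+1]C[k+1]≡[n+1]*nCk n k) ([k+1]*[n+1]C[k+1]≡[n+1]*nCk n (suc k)) ⟩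
  suc n ℕ.* (n C k) ℕ.+ suc n C suc k ℕ.+ suc n ℕ.* (n C suc k)
    ≡⟨ ≡.cong (λ a → suc n ℕ.* (n C k) ℕ.+ a ℕ.+ suc n ℕ.* (n C suc k)) (nCk+nC[k+1]≡[n+1]C[k+1] n k) ⟨
  suc n ℕ.* (n C k) ℕ.+ (n C k ℕ.+ n C suc k) ℕ.+ suc n ℕ.* (n C suc k)
    ≡⟨ solve 3 (λ n a b → (con 1 :+ n) :* a :+ (a :+ b) :+ (con 1 :+ n) :* b := (con 2 :+ n) :* (a :+ b)) ≡.refl n (n C k) (n C suc k) ⟩
  suc (suc n) ℕ.* (n C k ℕ.+ n C suc k)
    ≡⟨ ≡.cong (suc (suc n) ℕ.*_) (nCk+nC[k+1]≡[n+1]C[k+1] n k) ⟩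
  suc (suc n) ℕ.* (suc n C suc k) ∎
  where open ≡.≡-Reasoning
        open +-*-Solver

p∣pCk : ∀ {p k} → Prime p → 0 < k → k < p → p ∣ p C k
p∣pCk {suc n} {suc k} p-prime _ k<p = coprime-divisor (prime⇒coprime p-prime k<p)
  (divides (n C k) (≡.trans ([k+1]*[n+1]C[k+1]≡[n+1]*nCk n k) (ℕ.*-comm (suc n) (n C k))))

pascal-∸ : ∀ j i → (suc j ∸ i) C suc i ≡ (j ∸ i) C suc i ℕ.+ (j ∸ i) C i
pascal-∸ j i with i ℕ.≤? j
... | yes i≤j rewrite ℕ.+-∸-assoc 1 i≤j =
  ≡.trans (≡.sym (nCk+nC[k+1]≡[n+1]C[k+1] (j ∸ i) i)) (ℕ.+-comm ((j ∸ i) C i) _)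
... | no i≰j = beyond-the-range j i (ℕ.≰⇒> i≰j)
  where
  beyond-the-range : ∀ j i → j < i → (suc j ∸ i) C suc i ≡ (j ∸ i) C suc i ℕ.+ (j ∸ i) C i
  beyond-the-range j (suc i) (s≤s j≤i) rewrite ℕ.m≤n⇒m∸n≡0 j≤i | ℕ.m≤n⇒m∸n≡0 (ℕ.m≤n⇒m≤1+n j≤i) = ≡.refl

n<2[1+n/2] : ∀ n → n < suc (n / 2) ℕ.+ suc (n / 2)
n<2[1+n/2] n = begin-strict
  n                         ≡⟨ m≡m%n+[m/n]*n n 2 ⟩
  n % 2 ℕ.+ h ℕ.* 2         <⟨ ℕ.+-monoˡ-< (h ℕ.* 2) (m%n<n n 2) ⟩
  2 ℕ.+ h ℕ.* 2             ≡⟨ solve 1 (λ h → con 2 :+ h :* con 2 := (con 1 :+ h) :+ (con 1 :+ h)) ≡.refl h ⟩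
  suc h ℕ.+ suc h           ∎
  where
  open ℕ.≤-Reasoning
  open +-*-Solver
  h : ℕ
  h = n / 2

odd-prime : ∀ {p} → Prime p → p ≢ 2 → ∃ λ t → p ≡ suc (suc (suc (t ℕ.+ t)))
odd-prime {p} p-prime p≢2 = from-division (p % 2) (p / 2) (m%n<n p 2) (m≡m%n+[m/n]*n p 2)
  where
  open +-*-Solver
  ¬prime1 : ¬ Prime 1
  ¬prime1 ()
  from-division : ∀ r u → r < 2 → p ≡ r ℕ.+ u ℕ.* 2 → ∃ λ t → p ≡ suc (suc (suc (t ℕ.+ t)))
  from-division zero          u       _ p≡2u with prime⇒irreducible p-prime (divides u p≡2u)
  ... | inj₁ ()
  ... | inj₂ p≡2 = ⊥-elim (p≢2 (≡.sym p≡2))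
  from-division (suc zero)    zero    _ ≡.refl = ⊥-elim (¬prime1 p-prime)
  from-division (suc zero)    (suc t) _ ≡.refl = t , solve 1 (λ t → con 1 :+ (con 1 :+ t) :* con 2 := con 3 :+ (t :+ t)) ≡.refl t
  from-division (suc (suc r)) _       (s≤s (s≤s ())) _

odd-power : ∀ {p} t → p ≡ suc (suc (suc (t ℕ.+ t))) → ∀ l → ∃ λ N → p ℕ.^ suc l ≡ suc (suc (suc (N ℕ.+ N)))
odd-power {p} t ≡.refl zero    = t , ℕ.*-identityʳ p
odd-power {p} t ≡.refl (suc l) with odd-power t ≡.refl l
... | N , p^[1+l]≡2N+3 = M , ≡.trans (≡.cong (p ℕ.*_) p^[1+l]≡2N+3)
        (solve 2 (λ t N → (con 3 :+ (t :+ t)) :* (con 3 :+ (N :+ N))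
                          := con 3 :+ ((t :* (N :+ N) :+ con 3 :* t :+ con 3 :* N :+ con 3) :+ (t :* (N :+ N) :+ con 3 :* t :+ con 3 :* N :+ con 3))) ≡.refl t N)
  where
  open +-*-Solver
  M : ℕ
  M = t ℕ.* (N ℕ.+ N) ℕ.+ 3 ℕ.* t ℕ.+ 3 ℕ.* N ℕ.+ 3

[z*d]/ℕd≡z : ∀ z d .{{_ : ℕ.NonZero d}} → (z ℤ.* ℤ.+ d) /ℕ d ≡ z
[z*d]/ℕd≡z (ℤ.+ a)    d = ≡.trans (≡.cong (_/ℕ d) (≡.sym (ℤ.pos-* a d))) (≡.cong ℤ.+_ (m*n/n≡m a d))
[z*d]/ℕd≡z ℤ.-[1+ a ] d@(suc d-1) with suc (d-1 ℕ.+ a ℕ.* d) % d in rem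
... | zero  = ≡.cong (λ v → ℤ.- (ℤ.+ v)) (m*n/n≡m (suc a) d)
... | suc r = contradiction (≡.trans (≡.sym rem) (m*n%n≡0 (suc a) d)) λ ()

Dcoef-zero : ∀ m k → Dcoef (suc m) k 0 ≡ ℤ.+ 1
Dcoef-zero m k = begin
  ((ℤ.+ suc m ℤ.- ℤ.+ (k ℕ.* 0)) ℤ.* ℤ.+ 1) /ℕ suc m ≡⟨ ≡.cong (λ v → ((ℤ.+ suc m ℤ.- ℤ.+ v) ℤ.* ℤ.+ 1) /ℕ suc m) (ℕ.*-zeroʳ k) ⟩
  ((ℤ.+ suc m ℤ.- ℤ.+ 0) ℤ.* ℤ.+ 1) /ℕ suc m         ≡⟨ ≡.cong (_/ℕ suc m) (ℤ.*-comm (ℤ.+ suc m ℤ.- ℤ.+ 0) (ℤ.+ 1)) ⟩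
  (ℤ.+ 1 ℤ.* (ℤ.+ suc m ℤ.- ℤ.+ 0)) /ℕ suc m         ≡⟨ ≡.cong (λ v → (ℤ.+ 1 ℤ.* v) /ℕ suc m) (ℤ.+-identityʳ (ℤ.+ suc m)) ⟩
  (ℤ.+ 1 ℤ.* ℤ.+ suc m) /ℕ suc m                     ≡⟨ [z*d]/ℕd≡z (ℤ.+ 1) (suc m) ⟩
  ℤ.+ 1 ∎
  where open ≡.≡-Reasoning

Dcoef-suc : ∀ r j k → Dcoef (suc r ℕ.+ suc j) (suc k) (suc j) ≡ (suc r C suc j) ⊖ (k ℕ.* (r C j))
Dcoef-suc r j k rewrite ℕ.m+n∸n≡m (suc r) (suc j) = begin
  ((ℤ.+ (suc r ℕ.+ suc j) ℤ.- ℤ.+ (suc k ℕ.* suc j)) ℤ.* X) /ℕ suc r ≡⟨ ≡.cong (_/ℕ suc r) numerator ⟩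
  ((X ℤ.- ℤ.+ (k ℕ.* (r C j))) ℤ.* A) /ℕ suc r                      ≡⟨ [z*d]/ℕd≡z _ (suc r) ⟩
  X ℤ.- ℤ.+ (k ℕ.* (r C j))                                         ≡⟨ ℤ.m-n≡m⊖n (suc r C suc j) (k ℕ.* (r C j)) ⟩
  (suc r C suc j) ⊖ (k ℕ.* (r C j)) ∎
  where
  open ≡.≡-Reasoning
  open Data.Integer.Solver.+-*-Solver
  A B K X Y : ℤ
  A = ℤ.+ suc r
  B = ℤ.+ suc j
  K = ℤ.+ k
  X = ℤ.+ (suc r C suc j)
  Y = ℤ.+ (r C j)
  absorption : B ℤ.* X ≡ A ℤ.* Y
  absorption = ≡.trans (≡.sym (ℤ.pos-* (suc j) _)) (≡.trans (≡.cong ℤ.+_ ([k+1]*[n+1]C[k+1]≡[n+1]*nCk r j)) (ℤ.pos-* (suc r) _))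
  numerator : (ℤ.+ (suc r ℕ.+ suc j) ℤ.- ℤ.+ (suc k ℕ.* suc j)) ℤ.* X ≡ (X ℤ.- ℤ.+ (k ℕ.* (r C j))) ℤ.* A
  numerator = begin
    (ℤ.+ (suc r ℕ.+ suc j) ℤ.- ℤ.+ (suc k ℕ.* suc j)) ℤ.* X
      ≡⟨ ≡.cong₂ (λ u v → (u ℤ.- v) ℤ.* X) (ℤ.pos-+ (suc r) (suc j)) (ℤ.pos-* (suc k) (suc j)) ⟩
    ((A ℤ.+ B) ℤ.- ℤ.+ suc k ℤ.* B) ℤ.* X
      ≡⟨ ≡.cong (λ v → ((A ℤ.+ B) ℤ.- v ℤ.* B) ℤ.* X) (ℤ.pos-+ 1 k) ⟩
    ((A ℤ.+ B) ℤ.- (ℤ.+ 1 ℤ.+ K) ℤ.* B) ℤ.* X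
      ≡⟨ solve 4 (λ A B K X → ((A :+ B) :- (con (ℤ.+ 1) :+ K) :* B) :* X := A :* X :- K :* (B :* X)) ≡.refl A B K X ⟩
    A ℤ.* X ℤ.- K ℤ.* (B ℤ.* X)
      ≡⟨ ≡.cong (λ v → A ℤ.* X ℤ.- K ℤ.* v) absorption ⟩
    A ℤ.* X ℤ.- K ℤ.* (A ℤ.* Y)
      ≡⟨ solve 4 (λ A K X Y → A :* X :- K :* (A :* Y) := (X :- K :* Y) :* A) ≡.refl A K X Y ⟩
    (X ℤ.- K ℤ.* Y) ℤ.* A
      ≡⟨ ≡.cong (λ v → (X ℤ.- v) ℤ.* A) (ℤ.pos-* k (r C j)) ⟨
    (X ℤ.- ℤ.+ (k ℕ.* (r C j))) ℤ.* A ∎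

module IntegerMultiples {c ℓ} (R : CommutativeRing c ℓ) where
  open CommutativeRing R
  open import Relation.Binary.Reasoning.Setoid setoid
  open import Algebra.Properties.Ring ring using (-1*x≈-x)
  open import Algebra.Properties.AbelianGroup +-abelianGroup using (⁻¹-∙-comm; ⁻¹-involutive; ε⁻¹≈ε)
  open import Algebra.Properties.Semiring.Mult.TCOptimised semiring public using (_×_; 1+×; ×-homo-+; ×1-homo-*)
  open import Algebra.Properties.CommutativeSemigroup +-commutativeSemigroup using () renaming (interchange to +-interchange)
  open import Algebra.Properties.CommutativeSemigroup *-commutativeSemigroup using () renaming (interchange to *-interchange)

  -- The TC-optimised multiple makes fromℤ (+ 0) and fromℤ (+ 1) reduce to 0# and 1#, so that
  -- the solver constants :0 and :1 below denote 0# and 1# definitionally.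
  fromℤ : ℤ → Carrier
  fromℤ (ℤ.+ n)    = n × 1#
  fromℤ ℤ.-[1+ n ] = - (suc n × 1#)

  [x+y]-[x+z]≈y-z : ∀ x y z → (x + y) - (x + z) ≈ y - z
  [x+y]-[x+z]≈y-z x y z = begin
    (x + y) - (x + z)     ≈⟨ +-congˡ (⁻¹-∙-comm x z) ⟨
    (x + y) + (- x - z)   ≈⟨ +-interchange x y (- x) (- z) ⟩
    (x - x) + (y - z)     ≈⟨ +-congʳ (-‿inverseʳ x) ⟩
    0# + (y - z)          ≈⟨ +-identityˡ _ ⟩
    y - z                 ∎

  fromℤ-⊖ : ∀ m n → fromℤ (m ⊖ n) ≈ m × 1# - n × 1#
  fromℤ-⊖ m       zero    = sym (trans (+-congˡ ε⁻¹≈ε) (+-identityʳ _))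
  fromℤ-⊖ zero    (suc n) = sym (+-identityˡ _)
  fromℤ-⊖ (suc m) (suc n) = begin
    fromℤ (suc m ⊖ suc n)                 ≡⟨ ≡.cong fromℤ (ℤ.[1+m]⊖[1+n]≡m⊖n m n) ⟩
    fromℤ (m ⊖ n)                         ≈⟨ fromℤ-⊖ m n ⟩
    m × 1# - n × 1#                       ≈⟨ [x+y]-[x+z]≈y-z 1# _ _ ⟨
    (1# + m × 1#) - (1# + n × 1#)         ≈⟨ +-cong (1+× m 1#) (-‿cong (1+× n 1#)) ⟨
    suc m × 1# - suc n × 1#               ∎

  fromℤ-+ : ∀ i j → fromℤ (i ℤ.+ j) ≈ fromℤ i + fromℤ j
  fromℤ-+ (ℤ.+ m)    (ℤ.+ n)    = ×-homo-+ 1# m n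
  fromℤ-+ (ℤ.+ m)    ℤ.-[1+ n ] = fromℤ-⊖ m (suc n)
  fromℤ-+ ℤ.-[1+ m ] (ℤ.+ n)    = trans (fromℤ-⊖ n (suc m)) (+-comm _ _)
  fromℤ-+ ℤ.-[1+ m ] ℤ.-[1+ n ] = begin
    - (suc (suc (m ℕ.+ n)) × 1#)          ≡⟨ ≡.cong (λ k → - (suc k × 1#)) (ℕ.+-suc m n) ⟨
    - ((suc m ℕ.+ suc n) × 1#)            ≈⟨ -‿cong (×-homo-+ 1# (suc m) (suc n)) ⟩
    - (suc m × 1# + suc n × 1#)           ≈⟨ ⁻¹-∙-comm _ _ ⟨
    - (suc m × 1#) - (suc n × 1#)         ∎

  fromℤ-neg : ∀ i → fromℤ (ℤ.- i) ≈ - fromℤ i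
  fromℤ-neg (ℤ.+ zero)  = sym ε⁻¹≈ε
  fromℤ-neg (ℤ.+ suc n) = refl
  fromℤ-neg ℤ.-[1+ n ]  = sym (⁻¹-involutive _)

  fromSign : Sign → Carrier
  fromSign Sign.+ = 1#
  fromSign Sign.- = - 1#

  fromSign-* : ∀ s t → fromSign (s Sign.* t) ≈ fromSign s * fromSign t
  fromSign-* Sign.+ t      = sym (*-identityˡ _)
  fromSign-* Sign.- Sign.+ = sym (*-identityʳ _)
  fromSign-* Sign.- Sign.- = sym (trans (-1*x≈-x _) (⁻¹-involutive _))

  fromℤ-◃ : ∀ s n → fromℤ (s ◃ n) ≈ fromSign s * (n × 1#)
  fromℤ-◃ s      zero    = sym (zeroʳ _)
  fromℤ-◃ Sign.+ (suc n) = sym (*-identityˡ _)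
  fromℤ-◃ Sign.- (suc n) = sym (-1*x≈-x _)

  fromℤ-sign-abs : ∀ i → fromℤ i ≈ fromSign (sign i) * (∣ i ∣ × 1#)
  fromℤ-sign-abs i = trans (reflexive (≡.cong fromℤ (≡.sym (ℤ.◃-inverse i)))) (fromℤ-◃ (sign i) ∣ i ∣)

  fromℤ-* : ∀ i j → fromℤ (i ℤ.* j) ≈ fromℤ i * fromℤ j
  fromℤ-* i j = begin
    fromℤ (sign i Sign.* sign j ◃ ∣ i ∣ ℕ.* ∣ j ∣)                          ≈⟨ fromℤ-◃ (sign i Sign.* sign j) (∣ i ∣ ℕ.* ∣ j ∣) ⟩
    fromSign (sign i Sign.* sign j) * ((∣ i ∣ ℕ.* ∣ j ∣) × 1#)              ≈⟨ *-cong (fromSign-* (sign i) (sign j)) (×1-homo-* ∣ i ∣ ∣ j ∣) ⟩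
    (fromSign (sign i) * fromSign (sign j)) * ((∣ i ∣ × 1#) * (∣ j ∣ × 1#)) ≈⟨ *-interchange _ _ _ _ ⟩
    (fromSign (sign i) * (∣ i ∣ × 1#)) * (fromSign (sign j) * (∣ j ∣ × 1#)) ≈⟨ *-cong (fromℤ-sign-abs i) (fromℤ-sign-abs j) ⟨
    fromℤ i * fromℤ j                                                     ∎

  fromℤ-homomorphism : ℤ.+-*-rawRing -Raw-AlmostCommutative⟶ fromCommutativeRing R
  fromℤ-homomorphism = record
    { ⟦_⟧ = fromℤ ; +-homo = fromℤ-+ ; *-homo = fromℤ-* ; -‿homo = fromℤ-neg
    ; 0-homo = refl ; 1-homo = refl }

  fromℤ-≟ : ∀ i j → Maybe (fromℤ i ≈ fromℤ j)
  fromℤ-≟ i j with i ℤ.≟ j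
  ... | yes ≡.refl = just refl
  ... | no _       = nothing

  module RingSolver where
    open Algebra.Solver.Ring ℤ.+-*-rawRing (fromCommutativeRing R) fromℤ-homomorphism fromℤ-≟ public

    :0 :1 :4 : ∀ {n} → Polynomial n
    :0 = con (ℤ.+ 0)
    :1 = con (ℤ.+ 1)
    :4 = con (ℤ.+ 4)

module RingLemmas {c ℓ} (R : CommutativeRing c ℓ) where
  open CommutativeRing R
  open import Relation.Binary.Reasoning.Setoid setoid
  open import Algebra.Properties.Semiring.Exp semiring using (_^_)

  1#^n≈1# : ∀ n → 1# ^ n ≈ 1#
  1#^n≈1# zero    = refl
  1#^n≈1# (suc n) = trans (*-identityˡ _) (1#^n≈1# n)

  module _ {h} (h+h≈1 : h + h ≈ 1#) where

    x*[h+h]≈x : ∀ x → x * (h + h) ≈ x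
    x*[h+h]≈x x = trans (*-congˡ h+h≈1) (*-identityʳ x)

    *h-cancel : ∀ {x y} → x * h ≈ y * h → x ≈ y
    *h-cancel {x} {y} xh≈yh = begin
      x                  ≈⟨ x*[h+h]≈x x ⟨
      x * (h + h)        ≈⟨ distribˡ x h h ⟩
      x * h + x * h      ≈⟨ +-cong xh≈yh xh≈yh ⟩
      y * h + y * h      ≈⟨ distribˡ y h h ⟨
      y * (h + h)        ≈⟨ x*[h+h]≈x y ⟩
      y                  ∎

module Characteristic {c ℓ} (R : CommutativeRing c ℓ) where
  open CommutativeRing R
  open import Relation.Binary.Reasoning.Setoid setoid
  open import Algebra.Properties.Semiring.Mult semiring using (×-assocˡ; ×-congʳ; ×-assoc-*) renaming (_×_ to _×ᵤ_)
  open import Algebra.Properties.Semiring.Mult.TCOptimised semiring using (_×_; 1+×; ×ᵤ≈×)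
  open import Algebra.Properties.Semiring.Exp semiring using (_^_; ^-congˡ; ^-assocʳ)
  open import Algebra.Properties.Monoid.Sum +-monoid using (sum; sum-init-last)
  import Algebra.Properties.CommutativeSemiring.Binomial commutativeSemiring as Binomial
  open RingLemmas R using (1#^n≈1#)

  binomial-collapse : ∀ n x y → (∀ k z → 0 < k → k < suc n → (suc n C k) ×ᵤ z ≈ 0#) →
                      (x + y) ^ suc n ≈ x ^ suc n + y ^ suc n
  binomial-collapse n x y middle-vanishes = begin
    (x + y) ^ suc n                                    ≈⟨ Binomial.theorem (suc n) x y ⟩
    t Fin.zero + sum (λ i → t (Fin.suc i))             ≈⟨ +-congˡ (sum-init-last (λ i → t (Fin.suc i))) ⟩
    t Fin.zero + (sum (λ i → t (Fin.suc (inject₁ i))) + t (Fin.suc (fromℕ n)))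
                                                       ≈⟨ +-congˡ (+-congʳ (sum-zero n (λ i → t (Fin.suc (inject₁ i))) middle)) ⟩
    t Fin.zero + (0# + t (Fin.suc (fromℕ n)))          ≈⟨ +-cong first (trans (+-identityˡ _) last) ⟩
    y ^ suc n + x ^ suc n                              ≈⟨ +-comm _ _ ⟩
    x ^ suc n + y ^ suc n                              ∎
    where
    t : Fin (suc (suc n)) → Carrier
    t = Binomial.binomialTerm x y (suc n)
    sum-zero : ∀ m (f : Fin m → Carrier) → (∀ i → f i ≈ 0#) → sum f ≈ 0#
    sum-zero zero    f f≈0 = refl
    sum-zero (suc m) f f≈0 = trans (+-cong (f≈0 Fin.zero) (sum-zero m (λ i → f (Fin.suc i)) (λ i → f≈0 (Fin.suc i)))) (+-identityʳ 0#)
    middle : ∀ i → t (Fin.suc (inject₁ i)) ≈ 0#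
    middle i = middle-vanishes _ _ (s≤s z≤n) (s≤s (≡.subst (_< n) (≡.sym (Fin.toℕ-inject₁ i)) (Fin.toℕ<n i)))
    first : t Fin.zero ≈ y ^ suc n
    first = trans (+-identityʳ _) (*-identityˡ _)
    last : t (Fin.suc (fromℕ n)) ≈ x ^ suc n
    last rewrite Fin.toℕ-fromℕ n | nCn≡1 (suc n) | ℕ.n∸n≡0 n = trans (+-identityʳ _) (*-identityʳ _)

  module _ {p} (p-prime : Prime p) (char : p × 1# ≈ 0#) where

    private
      n : ℕ
      n = ℕ.pred p
      p≡1+n : p ≡ suc n
      p≡1+n = ≡.sym (ℕ.suc-pred p {{prime⇒nonZero p-prime}})

    p∣n⇒n×x≈0 : ∀ {n} x → p ∣ n → n ×ᵤ x ≈ 0#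
    p∣n⇒n×x≈0 x (divides m ≡.refl) = begin
      (m ℕ.* p) ×ᵤ x          ≡⟨ ≡.cong (_×ᵤ x) (ℕ.*-comm m p) ⟩
      (p ℕ.* m) ×ᵤ x          ≈⟨ ×-assocˡ x p m ⟨
      p ×ᵤ (m ×ᵤ x)           ≈⟨ ×-congʳ p (*-identityˡ _) ⟨
      p ×ᵤ (1# * (m ×ᵤ x))    ≈⟨ ×-assoc-* p 1# (m ×ᵤ x) ⟨
      (p ×ᵤ 1#) * (m ×ᵤ x)    ≈⟨ *-congʳ (trans (×ᵤ≈× p 1#) char) ⟩
      0# * (m ×ᵤ x)           ≈⟨ zeroˡ _ ⟩
      0#                      ∎

    frobenius : ∀ x y → (x + y) ^ p ≈ x ^ p + y ^ p
    frobenius x y = ≡.subst (λ m → (x + y) ^ m ≈ x ^ m + y ^ m) (≡.sym p≡1+n)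
      (binomial-collapse n x y λ k z 0<k k<1+n →
        ≡.subst (λ m → (m C k) ×ᵤ z ≈ 0#) p≡1+n
          (p∣n⇒n×x≈0 z (p∣pCk p-prime 0<k (≡.subst (k <_) (≡.sym p≡1+n) k<1+n))))

    frobenius-^ : ∀ l x y → (x + y) ^ (p ℕ.^ l) ≈ x ^ (p ℕ.^ l) + y ^ (p ℕ.^ l)
    frobenius-^ zero    x y = trans (*-identityʳ _) (sym (+-cong (*-identityʳ x) (*-identityʳ y)))
    frobenius-^ (suc l) x y = begin
      (x + y) ^ (p ℕ.* p ℕ.^ l)                   ≈⟨ ^-assocʳ (x + y) p (p ℕ.^ l) ⟨
      ((x + y) ^ p) ^ (p ℕ.^ l)                   ≈⟨ ^-congˡ (p ℕ.^ l) (frobenius x y) ⟩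
      (x ^ p + y ^ p) ^ (p ℕ.^ l)                 ≈⟨ frobenius-^ l (x ^ p) (y ^ p) ⟩
      (x ^ p) ^ (p ℕ.^ l) + (y ^ p) ^ (p ℕ.^ l)   ≈⟨ +-cong (^-assocʳ x p (p ℕ.^ l)) (^-assocʳ y p (p ℕ.^ l)) ⟩
      x ^ (p ℕ.* p ℕ.^ l) + y ^ (p ℕ.* p ℕ.^ l)   ∎

    fermat : ∀ m → (m × 1#) ^ p ≈ m × 1#
    fermat zero    = ≡.subst (λ m → 0# ^ m ≈ 0#) (≡.sym p≡1+n) (zeroˡ _)
    fermat (suc m) = begin
      (suc m × 1#) ^ p        ≈⟨ ^-congˡ p (1+× m 1#) ⟩
      (1# + m × 1#) ^ p       ≈⟨ frobenius 1# (m × 1#) ⟩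
      1# ^ p + (m × 1#) ^ p   ≈⟨ +-cong (1#^n≈1# p) (fermat m) ⟩
      1# + m × 1#             ≈⟨ 1+× m 1# ⟨
      suc m × 1#              ∎

    fermat-^ : ∀ l m → (m × 1#) ^ (p ℕ.^ l) ≈ m × 1#
    fermat-^ zero    m = *-identityʳ _
    fermat-^ (suc l) m = begin
      (m × 1#) ^ (p ℕ.* p ℕ.^ l)     ≈⟨ ^-assocʳ (m × 1#) p (p ℕ.^ l) ⟨
      ((m × 1#) ^ p) ^ (p ℕ.^ l)     ≈⟨ ^-congˡ (p ℕ.^ l) (fermat m) ⟩
      (m × 1#) ^ (p ℕ.^ l)           ≈⟨ fermat-^ l m ⟩
      m × 1#                         ∎

module SecondKind {c ℓ} (R : CommutativeRing c ℓ) where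
  open CommutativeRing R
  open import Relation.Binary.Reasoning.Setoid setoid
  open IntegerMultiples R using (_×_; ×-homo-+; module RingSolver)
  open import Algebra.Properties.Semiring.Exp semiring using (_^_)
  open RingSolver using (solve; _:+_; _:*_; _:-_; :-_; _:=_; :1)

  E : Carrier → ℕ → Carrier
  E x zero                = 1#
  E x (suc zero)          = 1#
  E x (suc (suc j))       = E x (suc j) - x * E x j

  E-root-powers : ∀ x y → y * y ≈ y - x → ∀ j → y ^ suc (suc j) ≈ E x (suc j) * y - x * E x j
  E-root-powers x y y²≈y-x zero = begin
    y * (y * 1#)        ≈⟨ *-congˡ (*-identityʳ y) ⟩
    y * y               ≈⟨ y²≈y-x ⟩
    y - x               ≈⟨ solve 2 (λ x y → y :- x := :1 :* y :- x :* :1) refl x y ⟩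
    1# * y - x * 1#     ∎
  E-root-powers x y y²≈y-x (suc j) = begin
    y * y ^ suc (suc j)                  ≈⟨ *-congˡ (E-root-powers x y y²≈y-x j) ⟩
    y * (E₁ * y - x * E₀)                ≈⟨ solve 4 (λ x y E₁ E₀ → y :* (E₁ :* y :- x :* E₀) := E₁ :* (y :* y) :- x :* E₀ :* y) refl x y E₁ E₀ ⟩
    E₁ * (y * y) - x * E₀ * y            ≈⟨ +-congʳ (*-congˡ y²≈y-x) ⟩
    E₁ * (y - x) - x * E₀ * y            ≈⟨ solve 4 (λ x y E₁ E₀ → E₁ :* (y :- x) :- x :* E₀ :* y := (E₁ :- x :* E₀) :* y :- x :* E₁) refl x y E₁ E₀ ⟩
    (E₁ - x * E₀) * y - x * E₁           ∎
    where
    E₁ E₀ : Carrier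
    E₁ = E x (suc j)
    E₀ = E x j

  sum< : ℕ → (ℕ → Carrier) → Carrier
  sum< zero    f = 0#
  sum< (suc N) f = f 0 + sum< N (λ i → f (suc i))

  sum<-cong : ∀ N {f g} → (∀ i → i < N → f i ≈ g i) → sum< N f ≈ sum< N g
  sum<-cong zero    f≈g = refl
  sum<-cong (suc N) f≈g = +-cong (f≈g 0 (s≤s z≤n)) (sum<-cong N λ i i<N → f≈g (suc i) (s≤s i<N))

  sum<-+ : ∀ N f g → sum< N (λ i → f i + g i) ≈ sum< N f + sum< N g
  sum<-+ zero    f g = sym (+-identityʳ 0#)
  sum<-+ (suc N) f g = begin
    (f 0 + g 0) + sum< N (λ i → f (suc i) + g (suc i))        ≈⟨ +-congˡ (sum<-+ N _ _) ⟩
    (f 0 + g 0) + (sum< N (λ i → f (suc i)) + sum< N (λ i → g (suc i)))  ≈⟨ +-interchange _ _ _ _ ⟩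
    (f 0 + sum< N (λ i → f (suc i))) + (g 0 + sum< N (λ i → g (suc i)))  ∎
    where open import Algebra.Properties.CommutativeSemigroup +-commutativeSemigroup using () renaming (interchange to +-interchange)

  sum<-*ˡ : ∀ N a f → sum< N (λ i → a * f i) ≈ a * sum< N f
  sum<-*ˡ zero    a f = sym (zeroʳ a)
  sum<-*ˡ (suc N) a f = trans (+-congˡ (sum<-*ˡ N a _)) (sym (distribˡ _ _ _))

  sum<-suc : ∀ N f → sum< (suc N) f ≈ sum< N f + f N
  sum<-suc zero    f = trans (+-identityʳ _) (sym (+-identityˡ _))
  sum<-suc (suc N) f = trans (+-congˡ (sum<-suc N _)) (sym (+-assoc _ _ _))

  E-term : Carrier → ℕ → ℕ → Carrier
  E-term x j i = ((j ∸ i) C i) × 1# * (- x) ^ i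

  Esum : Carrier → ℕ → ℕ → Carrier
  Esum x j N = sum< N (E-term x j)

  Esum-suc : ∀ x j N → j < N ℕ.+ N → Esum x j (suc N) ≈ Esum x j N
  Esum-suc x j N@(suc _) j<2N = begin
    Esum x j (suc N)                          ≈⟨ sum<-suc N (E-term x j) ⟩
    Esum x j N + ((j ∸ N) C N) × 1# * (- x) ^ N ≡⟨ ≡.cong (λ c → Esum x j N + c × 1# * (- x) ^ N) (k>n⇒nCk≡0 (ℕ.m<n+o⇒m∸n<o j N j<2N)) ⟩
    Esum x j N + 0# * (- x) ^ N               ≈⟨ +-congˡ (zeroˡ _) ⟩
    Esum x j N + 0#                           ≈⟨ +-identityʳ _ ⟩
    Esum x j N                                ∎

  Esum-mono : ∀ x j {N N′} → j < N ℕ.+ N → N ≤ N′ → Esum x j N′ ≈ Esum x j N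
  Esum-mono x j {N} {N′} j<2N N≤N′ with ℕ.m≤n⇒∃[o]m+o≡n N≤N′
  ... | o , ≡.refl = go o
    where
    go : ∀ o → Esum x j (N ℕ.+ o) ≈ Esum x j N
    go zero    = ≡.subst (λ M → Esum x j M ≈ Esum x j N) (≡.sym (ℕ.+-identityʳ N)) refl
    go (suc o) = ≡.subst (λ M → Esum x j M ≈ Esum x j N) (≡.sym (ℕ.+-suc N o))
      (trans (Esum-suc x j (N ℕ.+ o) (ℕ.<-≤-trans j<2N (ℕ.+-mono-≤ (ℕ.m≤m+n N o) (ℕ.m≤m+n N o)))) (go o))

  Esum[1]≈1 : ∀ x → Esum x 0 1 ≈ 1#
  Esum[1]≈1 x = trans (+-identityʳ _) (*-identityʳ 1#)

  Esum-rec : ∀ x j N → Esum x (suc (suc j)) (suc N) ≈ Esum x (suc j) (suc N) - x * Esum x j N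
  Esum-rec x j N = begin
    1# * 1# + sum< N (λ i → A i × 1# * (- x) ^ suc i)
      ≈⟨ +-congˡ (sum<-cong N λ i _ → pascal-term i) ⟩
    1# * 1# + sum< N (λ i → B i × 1# * (- x) ^ suc i + (- x) * (Cc i × 1# * (- x) ^ i))
      ≈⟨ +-congˡ (trans (sum<-+ N _ _) (+-congˡ (sum<-*ˡ N (- x) _))) ⟩
    1# * 1# + (S + (- x) * Esum x j N)
      ≈⟨ solve 4 (λ a b x e → a :+ (b :+ (:- x) :* e) := (a :+ b) :- x :* e) refl (1# * 1#) S x (Esum x j N) ⟩
    (1# * 1# + S) - x * Esum x j N ∎
    where
    A B Cc : ℕ → ℕ
    A i  = (suc j ∸ i) C suc i
    B i  = (j ∸ i) C suc i
    Cc i = (j ∸ i) C i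
    S : Carrier
    S = sum< N (λ i → B i × 1# * (- x) ^ suc i)
    pascal-term : ∀ i → A i × 1# * (- x) ^ suc i ≈ B i × 1# * (- x) ^ suc i + (- x) * (Cc i × 1# * (- x) ^ i)
    pascal-term i = begin
      A i × 1# * (- x) ^ suc i                            ≡⟨ ≡.cong (λ c → c × 1# * (- x) ^ suc i) (pascal-∸ j i) ⟩
      (B i ℕ.+ Cc i) × 1# * (- x) ^ suc i                 ≈⟨ *-congʳ (×-homo-+ 1# (B i) (Cc i)) ⟩
      (B i × 1# + Cc i × 1#) * ((- x) * (- x) ^ i)        ≈⟨ solve 4 (λ b c y z → (b :+ c) :* (y :* z) := b :* (y :* z) :+ y :* (c :* z)) refl _ _ _ _ ⟩
      B i × 1# * (- x) ^ suc i + (- x) * (Cc i × 1# * (- x) ^ i) ∎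

  Esum≈E : ∀ x j N → j < N ℕ.+ N → Esum x j N ≈ E x j
  Esum≈E x j             zero    ()
  Esum≈E x zero          (suc N) _ = trans (Esum-mono x 0 {1} {suc N} (s≤s z≤n) (s≤s z≤n)) (Esum[1]≈1 x)
  Esum≈E x (suc zero)    (suc N) _ = trans (Esum-mono x 1 {1} {suc N} (s≤s (s≤s z≤n)) (s≤s z≤n)) (Esum[1]≈1 x)
  Esum≈E x (suc (suc j)) (suc N) j+2<2N+2 = begin
    Esum x (suc (suc j)) (suc N)                      ≈⟨ Esum-rec x j N ⟩
    Esum x (suc j) (suc N) - x * Esum x j N           ≈⟨ +-cong (Esum≈E x (suc j) (suc N) (ℕ.<-trans (ℕ.n<1+n _) j+2<2N+2))
                                                                (-‿cong (*-congˡ (Esum≈E x j N j<2N))) ⟩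
    E x (suc j) - x * E x j                           ∎
    where
    j<2N : j < N ℕ.+ N
    j<2N = ℕ.≤-pred (ℕ.≤-pred (≡.subst (suc (suc (suc j)) ≤_) (≡.cong suc (ℕ.+-suc N N)) j+2<2N+2))

module GeneralizedDickson {c ℓ} (R : CommutativeRing c ℓ) where
  open CommutativeRing R
  open import Relation.Binary.Reasoning.Setoid setoid
  open import Algebra.Properties.Semiring.Exp semiring using (_^_)
  open IntegerMultiples R using (_×_; fromℤ; fromℤ-⊖; ×1-homo-*; module RingSolver)
  open RingSolver using (solve; _:+_; _:*_; _:-_; :-_; _:=_)
  open SecondKind R

  D-term : Carrier → ℕ → ℕ → ℕ → Carrier
  D-term x n k i = fromℤ (Dcoef n k i) * (- x) ^ i

  D-term-suc : ∀ x m k j → j ≤ m →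
               D-term x (suc (suc m)) (suc k) (suc j) ≈ E-term x (suc (suc m)) (suc j) + (k × 1# * x) * E-term x m j
  D-term-suc x m k j j≤m = begin
    fromℤ (Dcoef (suc (suc m)) (suc k) (suc j)) * (- x) ^ suc j
      ≡⟨ ≡.cong (λ n → fromℤ (Dcoef n (suc k) (suc j)) * (- x) ^ suc j) m+2≡[m-j+1]+[j+1] ⟩
    fromℤ (Dcoef (suc (m ∸ j) ℕ.+ suc j) (suc k) (suc j)) * (- x) ^ suc j
      ≡⟨ ≡.cong (λ z → fromℤ z * (- x) ^ suc j) (Dcoef-suc (m ∸ j) j k) ⟩
    fromℤ (A ⊖ (k ℕ.* B)) * (- x) ^ suc j
      ≈⟨ *-congʳ (trans (fromℤ-⊖ A (k ℕ.* B)) (+-congˡ (-‿cong (×1-homo-* k B)))) ⟩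
    (A × 1# - k × 1# * B × 1#) * ((- x) * (- x) ^ j)
      ≈⟨ solve 5 (λ a κ b x z → (a :- κ :* b) :* ((:- x) :* z) := a :* ((:- x) :* z) :+ (κ :* x) :* (b :* z)) refl _ _ _ _ _ ⟩
    A × 1# * (- x) ^ suc j + (k × 1# * x) * (B × 1# * (- x) ^ j)
      ≡⟨ ≡.cong (λ a → a × 1# * (- x) ^ suc j + (k × 1# * x) * (B × 1# * (- x) ^ j)) A≡ ⟩
    E-term x (suc (suc m)) (suc j) + (k × 1# * x) * E-term x m j ∎
    where
    A B : ℕ
    A = suc (m ∸ j) C suc j
    B = (m ∸ j) C j
    A≡ : A ≡ (suc m ∸ j) C suc j
    A≡ = ≡.cong (_C suc j) (≡.sym (ℕ.+-∸-assoc 1 j≤m))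
    m+2≡[m-j+1]+[j+1] : suc (suc m) ≡ suc (m ∸ j) ℕ.+ suc j
    m+2≡[m-j+1]+[j+1] = ≡.cong suc (≡.trans (≡.cong suc (≡.sym (ℕ.m∸n+n≡m j≤m))) (≡.sym (ℕ.+-suc (m ∸ j) j)))

  Dsum : Carrier → ℕ → ℕ → ℕ → Carrier
  Dsum x n k N = sum< N (D-term x n k)

  Dsum-split : ∀ x m k N → N ≤ suc m →
               Dsum x (suc (suc m)) (suc k) (suc N) ≈ Esum x (suc (suc m)) (suc N) + (k × 1# * x) * Esum x m N
  Dsum-split x m k N N≤1+m = begin
    D-term x n (suc k) 0 + sum< N (λ j → D-term x n (suc k) (suc j))
      ≈⟨ +-cong (*-congʳ (reflexive (≡.cong fromℤ (Dcoef-zero (suc m) (suc k)))))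
                (sum<-cong N λ j j<N → D-term-suc x m k j (ℕ.≤-pred (ℕ.≤-trans j<N N≤1+m))) ⟩
    1# * 1# + sum< N (λ j → E-term x n (suc j) + (k × 1# * x) * E-term x m j)
      ≈⟨ +-congˡ (trans (sum<-+ N _ _) (+-congˡ (sum<-*ˡ N (k × 1# * x) (E-term x m)))) ⟩
    1# * 1# + (sum< N (λ j → E-term x n (suc j)) + (k × 1# * x) * Esum x m N)
      ≈⟨ +-assoc _ _ _ ⟨
    Esum x n (suc N) + (k × 1# * x) * Esum x m N ∎
    where
    n : ℕ
    n = suc (suc m)

  Dsum≈E : ∀ x m k → Dsum x (suc (suc m)) (suc k) (suc (suc (suc m) / 2)) ≈ E x (suc (suc m)) + (k × 1# * x) * E x m
  Dsum≈E x m k rewrite m/n≡1+[m∸n]/n {suc (suc m)} {2} (s≤s (s≤s z≤n)) = begin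
    Dsum x (suc (suc m)) (suc k) (suc (suc H))                             ≈⟨ Dsum-split x m k (suc H) (s≤s (m/n≤m m 2)) ⟩
    Esum x (suc (suc m)) (suc (suc H)) + (k × 1# * x) * Esum x m (suc H)   ≈⟨ +-cong (Esum≈E x (suc (suc m)) (suc (suc H)) m+2<) (*-congˡ (Esum≈E x m (suc H) (n<2[1+n/2] m))) ⟩
    E x (suc (suc m)) + (k × 1# * x) * E x m                               ∎
    where
    H : ℕ
    H = m / 2
    m+2< : suc (suc m) < suc (suc H) ℕ.+ suc (suc H)
    m+2< = ≡.subst (suc (suc m) <_) (≡.cong suc (≡.sym (ℕ.+-suc (suc H) (suc H)))) (s≤s (s≤s (n<2[1+n/2] m)))

module QuadraticExtension {c ℓ} (R : CommutativeRing c ℓ) (d : CommutativeRing.Carrier R) where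
  open CommutativeRing R
  open IntegerMultiples R using (_×_; module RingSolver)
  open RingSolver using (solve; _:+_; _:*_; _:-_; _:=_; :0; :1)

  -- (a , b) stands for a + b √d.
  Q : Set c
  Q = Carrier Σ.× Carrier

  infix 4 _≈Q_
  _≈Q_ : Q → Q → Set ℓ
  (a , b) ≈Q (a′ , b′) = (a ≈ a′) Σ.× (b ≈ b′)

  infixl 6 _+Q_
  infixl 7 _*Q_
  infix  8 -Q_
  _+Q_ _*Q_ : Q → Q → Q
  (a , b) +Q (a′ , b′) = a + a′ , b + b′
  (a , b) *Q (a′ , b′) = a * a′ + d * (b * b′) , a * b′ + b * a′

  -Q_ : Q → Q
  -Q (a , b) = - a , - b

  ι : Carrier → Q
  ι a = a , 0#

  √d : Q
  √d = 0# , 1#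

  *Q-cong : ∀ {x x′ y y′} → x ≈Q x′ → y ≈Q y′ → x *Q y ≈Q x′ *Q y′
  *Q-cong (a≈ , b≈) (a′≈ , b′≈) = +-cong (*-cong a≈ a′≈) (*-congˡ (*-cong b≈ b′≈)) , +-cong (*-cong a≈ b′≈) (*-cong b≈ a′≈)

  *Q-assoc : ∀ x y z → (x *Q y) *Q z ≈Q x *Q (y *Q z)
  *Q-assoc (a , b) (a′ , b′) (a″ , b″) =
      solve 7 (λ d a b a′ b′ a″ b″ → (a :* a′ :+ d :* (b :* b′)) :* a″ :+ d :* ((a :* b′ :+ b :* a′) :* b″)
                                   := a :* (a′ :* a″ :+ d :* (b′ :* b″)) :+ d :* (b :* (a′ :* b″ :+ b′ :* a″))) refl d a b a′ b′ a″ b″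
    , solve 7 (λ d a b a′ b′ a″ b″ → (a :* a′ :+ d :* (b :* b′)) :* b″ :+ (a :* b′ :+ b :* a′) :* a″
                                   := a :* (a′ :* b″ :+ b′ :* a″) :+ b :* (a′ :* a″ :+ d :* (b′ :* b″))) refl d a b a′ b′ a″ b″

  *Q-comm : ∀ x y → x *Q y ≈Q y *Q x
  *Q-comm (a , b) (a′ , b′) =
      solve 5 (λ d a b a′ b′ → a :* a′ :+ d :* (b :* b′) := a′ :* a :+ d :* (b′ :* b)) refl d a b a′ b′
    , solve 4 (λ a b a′ b′ → a :* b′ :+ b :* a′ := a′ :* b :+ b′ :* a) refl a b a′ b′

  *Q-identityˡ : ∀ x → ι 1# *Q x ≈Q x
  *Q-identityˡ (a , b) = solve 3 (λ d a b → :1 :* a :+ d :* (:0 :* b) := a) refl d a b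
                       , solve 2 (λ a b → :1 :* b :+ :0 :* a := b) refl a b

  *Q-distribʳ : ∀ x y z → (y +Q z) *Q x ≈Q y *Q x +Q z *Q x
  *Q-distribʳ (a , b) (a′ , b′) (a″ , b″) =
      solve 7 (λ d a b a′ b′ a″ b″ → (a′ :+ a″) :* a :+ d :* ((b′ :+ b″) :* b)
                                   := (a′ :* a :+ d :* (b′ :* b)) :+ (a″ :* a :+ d :* (b″ :* b))) refl d a b a′ b′ a″ b″
    , solve 6 (λ a b a′ b′ a″ b″ → (a′ :+ a″) :* b :+ (b′ :+ b″) :* a
                                 := (a′ :* b :+ b′ :* a) :+ (a″ :* b :+ b″ :* a)) refl a b a′ b′ a″ b″

  isCommutativeRingQ : IsCommutativeRing _≈Q_ _+Q_ _*Q_ -Q_ (ι 0#) (ι 1#)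
  isCommutativeRingQ = record
    { isRing = record
      { +-isAbelianGroup = Additive.isAbelianGroup
      ; *-cong           = *Q-cong
      ; *-assoc          = *Q-assoc
      ; *-identity       = *Q-identityˡ , comm∧idˡ⇒idʳ *Q-comm *Q-identityˡ
      ; distrib          = comm∧distrʳ⇒distr Additive.∙-cong *Q-comm *Q-distribʳ }
    ; *-comm = *Q-comm }
    where
    module Additive = AbelianGroup (DirectProduct.abelianGroup +-abelianGroup +-abelianGroup)
    open import Algebra.Consequences.Setoid Additive.setoid using (comm∧idˡ⇒idʳ; comm∧distrʳ⇒distr)
  commutativeRingQ : CommutativeRing c ℓ
  commutativeRingQ = record { isCommutativeRing = isCommutativeRingQ }

  open import Algebra.Properties.Semiring.Exp semiring using (_^_)
  module Q where
    open CommutativeRing commutativeRingQ public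
    open import Algebra.Properties.Semiring.Exp (CommutativeRing.semiring commutativeRingQ) public using (_^_)
    open import Algebra.Properties.Semiring.Mult.TCOptimised (CommutativeRing.semiring commutativeRingQ) public using (_×_)

  ι-* : ∀ a b → ι a *Q ι b ≈Q ι (a * b)
  ι-* a b = solve 3 (λ d a b → a :* b :+ d :* (:0 :* :0) := a :* b) refl d a b
          , solve 2 (λ a b → a :* :0 :+ :0 :* b := :0) refl a b

  ι-- : ∀ a b → ι a Q.- ι b ≈Q ι (a - b)
  ι-- a b = refl , solve 0 (:0 :- :0 := :0) refl

  ι-×1 : ∀ n → n Q.× Q.1# ≈Q ι (n × 1#)
  ι-×1 zero          = refl , refl
  ι-×1 (suc zero)    = refl , refl
  ι-×1 (suc (suc n)) = +-congʳ (proj₁ (ι-×1 (suc n))) , trans (+-congʳ (proj₂ (ι-×1 (suc n)))) (+-identityʳ 0#)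

  √d-odd-power : ∀ M → √d Q.^ suc (M ℕ.+ M) ≈Q (0# , d ^ M)
  √d-odd-power zero    = solve 1 (λ d → :0 :* :1 :+ d :* (:1 :* :0) := :0) refl d
                       , solve 0 (:0 :* :0 :+ :1 :* :1 := :1) refl
  √d-odd-power (suc M) = Q.trans (Q.reflexive (≡.cong (λ k → √d Q.^ suc (suc k)) (ℕ.+-suc M M)))
    (Q.trans (Q.*-congˡ {√d} (Q.*-congˡ {√d} (√d-odd-power M)))
      ( solve 2 (λ d z → :0 :* (:0 :* :0 :+ d :* (:1 :* z)) :+ d :* (:1 :* (:0 :* z :+ :1 :* :0)) := :0) refl d (d ^ M)
      , solve 2 (λ d z → :0 :* (:0 :* z :+ :1 :* :0) :+ :1 :* (:0 :* :0 :+ d :* (:1 :* z)) := d :* z) refl d (d ^ M)))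

module SecondKindAtPrimePowers {c ℓ} (R : CommutativeRing c ℓ) where
  open CommutativeRing R
  open IntegerMultiples R using (_×_; module RingSolver)
  module ≈R = Relation.Binary.Reasoning.Setoid setoid
  open import Algebra.Properties.Semiring.Exp semiring using (_^_)
  open RingSolver using (solve; _:+_; _:*_; _:-_; _:=_; :0; :1; :4)
  open SecondKind R using (E)
  open RingLemmas R using (x*[h+h]≈x; *h-cancel)

  module Evaluated {p} (p-prime : Prime p) (char : p × 1# ≈ 0#) (m : ℕ) (half : m × 1# + m × 1# ≈ 1#) (x : Carrier) where

    h d : Carrier
    h = m × 1#
    d = 1# - (4 × 1#) * x

    open QuadraticExtension R d
    module ≈Q = Relation.Binary.Reasoning.Setoid Q.setoid
    module EQ = SecondKind commutativeRingQ
    open Characteristic commutativeRingQ using (fermat-^; frobenius-^)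
    open RingLemmas commutativeRingQ using (1#^n≈1#)
    open import Algebra.Properties.CommutativeSemiring.Exp (CommutativeRing.commutativeSemiring commutativeRingQ)
      using () renaming (^-distrib-* to ^Q-distrib-*)
    open import Algebra.Properties.Semiring.Exp (CommutativeRing.semiring commutativeRingQ)
      using () renaming (^-congˡ to ^Q-congˡ)

    y : Q
    y = h , h

    y²≈y-x : y Q.* y Q.≈ y Q.- ι x
    y²≈y-x = first , second
      where
      open ≈R
      first : h * h + d * (h * h) ≈ h - x
      first = begin
        h * h + d * (h * h)                        ≈⟨ solve 2 (λ h x → h :* h :+ (:1 :- :4 :* x) :* (h :* h)
                                                                   := h :* (h :+ h) :- x :* ((h :+ h) :* (h :+ h))) refl h x ⟩
        h * (h + h) - x * ((h + h) * (h + h))      ≈⟨ +-cong (x*[h+h]≈x half h) (-‿cong (*-congˡ (trans (x*[h+h]≈x half (h + h)) half))) ⟩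
        h - x * 1#                                 ≈⟨ +-congˡ (-‿cong (*-identityʳ x)) ⟩
        h - x                                      ∎
      second : h * h + h * h ≈ h - 0#
      second = begin
        h * h + h * h          ≈⟨ distribˡ h h h ⟨
        h * (h + h)            ≈⟨ x*[h+h]≈x half h ⟩
        h                      ≈⟨ solve 1 (λ h → h := h :- :0) refl h ⟩
        h - 0#                 ∎

    E-ι : ∀ j → EQ.E (ι x) j Q.≈ ι (E x j)
    E-ι zero          = refl , refl
    E-ι (suc zero)    = refl , refl
    E-ι (suc (suc j)) = Q.trans (Q.+-cong (E-ι (suc j)) (Q.-‿cong (Q.trans (Q.*-congˡ {ι x} (E-ι j)) (ι-* x (E x j)))))
                                (ι-- (E x (suc j)) (x * E x j))

    y-powers : ∀ j → y Q.^ suc (suc j) Q.≈ (E x (suc j) * h - x * E x j , E x (suc j) * h)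
    y-powers j = Q.trans (EQ.E-root-powers (ι x) y y²≈y-x j)
      (Q.trans (Q.+-cong (Q.*-congʳ {y} (E-ι (suc j))) (Q.-‿cong (Q.*-congˡ {ι x} (E-ι j))))
        ( solve 5 (λ d h x E₁ E₀ → (E₁ :* h :+ d :* (:0 :* h)) :- (x :* E₀ :+ d :* (:0 :* :0))
                                   := E₁ :* h :- x :* E₀) refl d h x (E x (suc j)) (E x j)
        , solve 4 (λ h x E₁ E₀ → (E₁ :* h :+ :0 :* h) :- (x :* :0 :+ :0 :* E₀)
                                   := E₁ :* h) refl h x (E x (suc j)) (E x j)))

    y≈h[1+√d] : y Q.≈ (m Q.× Q.1#) Q.* (Q.1# Q.+ √d)
    y≈h[1+√d] = Q.sym (Q.trans (Q.*-congʳ {Q.1# Q.+ √d} (ι-×1 m))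
      ( solve 2 (λ d h → h :* (:1 :+ :0) :+ d :* (:0 :* (:0 :+ :1)) := h) refl d h
      , solve 1 (λ h → h :* (:0 :+ :1) :+ :0 :* (:1 :+ :0) := h) refl h))

    charQ : p Q.× Q.1# Q.≈ Q.0#
    charQ = Q.trans (ι-×1 p) (char , refl)

    y-p-power : ∀ l N → p ℕ.^ l ≡ suc (N ℕ.+ N) → y Q.^ (p ℕ.^ l) Q.≈ (h , h * d ^ N)
    y-p-power l N p^l≡2N+1 = begin
      y Q.^ P                                                  ≈⟨ ^Q-congˡ P y≈h[1+√d] ⟩
      ((m Q.× Q.1#) Q.* (Q.1# Q.+ √d)) Q.^ P                    ≈⟨ ^Q-distrib-* _ _ P ⟩
      (m Q.× Q.1#) Q.^ P Q.* (Q.1# Q.+ √d) Q.^ P                ≈⟨ Q.*-cong (fermat-^ p-prime charQ l m) (frobenius-^ p-prime charQ l Q.1# √d) ⟩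
      (m Q.× Q.1#) Q.* (Q.1# Q.^ P Q.+ √d Q.^ P)                ≈⟨ Q.*-cong (ι-×1 m) (Q.+-cong (1#^n≈1# P) (Q.reflexive (≡.cong (√d Q.^_) p^l≡2N+1))) ⟩
      ι h Q.* (Q.1# Q.+ √d Q.^ suc (N ℕ.+ N))                   ≈⟨ Q.*-congˡ {ι h} (Q.+-congˡ {Q.1#} (√d-odd-power N)) ⟩
      ι h Q.* (Q.1# Q.+ (0# , d ^ N))                           ≈⟨ solve 3 (λ d h z → h :* (:1 :+ :0) :+ d :* (:0 :* (:0 :+ z)) := h) refl d h (d ^ N)
                                                                  , solve 2 (λ h z → h :* (:0 :+ z) :+ :0 :* (:1 :+ :0) := h :* z) refl h (d ^ N) ⟩
      (h , h * d ^ N)                                          ∎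
      where
      P : ℕ
      P = p ℕ.^ l
      open ≈Q

    module _ (l N : ℕ) (p^l≡2N+3 : p ℕ.^ l ≡ suc (suc (suc (N ℕ.+ N)))) where

      y-p^l : y Q.^ suc (suc (suc (N ℕ.+ N))) Q.≈ (h , h * d ^ suc N)
      y-p^l = ≡.subst (λ k → y Q.^ k Q.≈ (h , h * d ^ suc N)) p^l≡2N+3
        (y-p-power l (suc N) (≡.trans p^l≡2N+3 (≡.cong (λ k → suc (suc k)) (≡.sym (ℕ.+-suc N N)))))

      E[p^l-1] : E x (suc (suc (N ℕ.+ N))) ≈ d ^ suc N
      E[p^l-1] = *h-cancel half (trans (sym (proj₂ (y-powers (suc (N ℕ.+ N))))) (trans (proj₂ y-p^l) (*-comm h _)))

      E[p^l+1] : E x (suc (suc (suc (suc (N ℕ.+ N))))) ≈ h + d ^ suc N * (h - x)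
      E[p^l+1] = *h-cancel half (begin
        E x (suc (suc (suc (suc (N ℕ.+ N))))) * h            ≈⟨ proj₂ (y-powers (suc (suc (suc (N ℕ.+ N))))) ⟨
        proj₂ (y Q.* (y Q.* y Q.^ P))                         ≈⟨ proj₂ (Q.*-assoc y y (y Q.^ P)) ⟨
        proj₂ ((y Q.* y) Q.* y Q.^ P)                         ≈⟨ proj₂ (Q.*-cong y²≈y-x y-p^l) ⟩
        (h - x) * (h * dᴺ) + (h - 0#) * h                      ≈⟨ solve 3 (λ h x dᴺ → (h :- x) :* (h :* dᴺ) :+ (h :- :0) :* h
                                                                                  := (h :+ dᴺ :* (h :- x)) :* h) refl h x dᴺ ⟩
        (h + dᴺ * (h - x)) * h                                 ∎)
        where
        open ≈R
        P : ℕ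
        P = suc (suc (suc (N ℕ.+ N)))
        dᴺ : Carrier
        dᴺ = d ^ suc N

module FiniteFieldProperties {c ℓ q} (F : FiniteField c ℓ q) where
  open FiniteField F
  open import Relation.Binary.Reasoning.Setoid setoid
  open import Algebra.Properties.Semiring.Exp semiring using (_^_; ^-congˡ)
  open import Algebra.Properties.CommutativeSemiring.Exp commutativeSemiring using (^-distrib-*)
  open import Algebra.Properties.Semiring.Mult semiring using () renaming (_×_ to _×ᵤ_)
  open import Algebra.Properties.Semiring.Mult.TCOptimised semiring using (×ᵤ≈×)
  open IntegerMultiples cring using (_×_; fromℤ; ×1-homo-*; 1+×)
  open RingLemmas cring using (1#^n≈1#)
  open SecondKind cring using (E; sum<)
  open GeneralizedDickson cring using (D-term; Dsum≈E)
  open import Algebra.Properties.CommutativeMonoid.Sum +-commutativeMonoid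
    using (sum; sum-cong-≋; sum-permute; ∑-distrib-+; sum-replicate)

  ℕ→F≈× : ∀ n → ℕ→F F n ≈ n × 1#
  ℕ→F≈× n = trans (reflexive (ℕ→F≡×ᵤ n)) (×ᵤ≈× n 1#)
    where
    ℕ→F≡×ᵤ : ∀ n → ℕ→F F n ≡ n ×ᵤ 1#
    ℕ→F≡×ᵤ zero    = ≡.refl
    ℕ→F≡×ᵤ (suc n) = ≡.cong (λ v → 1# + v) (ℕ→F≡×ᵤ n)

  ℤ→F≈fromℤ : ∀ z → ℤ→F F z ≈ fromℤ z
  ℤ→F≈fromℤ (ℤ.+ n)    = ℕ→F≈× n
  ℤ→F≈fromℤ ℤ.-[1+ n ] = -‿cong (ℕ→F≈× (suc n))

  pow≡^ : ∀ x n → pow F x n ≡ x ^ n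
  pow≡^ x zero    = ≡.refl
  pow≡^ x (suc n) = ≡.cong (x *_) (pow≡^ x n)

  D≈Dsum : ∀ n k x → D F n k x ≈ sum< (suc (n ℕ./ 2)) (D-term x n k)
  D≈Dsum n k x = go (λ i → i) (suc (n ℕ./ 2))
    where
    go : ∀ f N → foldr _+_ 0# (map (λ i → ℤ→F F (Dcoef n k i) * pow F (- x) i) (applyUpTo f N))
                  ≈ sum< N (λ i → D-term x n k (f i))
    go f zero    = refl
    go f (suc N) = +-cong (*-cong (ℤ→F≈fromℤ (Dcoef n k (f 0))) (reflexive (pow≡^ (- x) (f 0)))) (go (λ i → f (suc i)) N)

  D-formula : ∀ m k x → D F (suc (suc m)) (suc k) x ≈ E x (suc (suc m)) + (k × 1# * x) * E x m
  D-formula m k x = trans (D≈Dsum (suc (suc m)) (suc k) x) (Dsum≈E x m k)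

  index : Carrier → Fin q
  index x = proj₁ (enum-surj x)

  enum-index : ∀ x → enum (index x) ≈ x
  enum-index x = proj₂ (enum-surj x)

  _≟_ : Decidable _≈_
  x ≟ y with index x Fin.≟ index y
  ... | yes i≡j = yes (trans (sym (enum-index x)) (trans (reflexive (≡.cong enum i≡j)) (enum-index y)))
  ... | no  i≢j = no λ x≈y → i≢j (enum-inj _ _ (trans (enum-index x) (trans x≈y (sym (enum-index y)))))

  x^n≈0⇒x≈0 : ∀ x n → x ^ n ≈ 0# → x ≈ 0#
  x^n≈0⇒x≈0 x n xⁿ≈0 with x ≟ 0#
  ... | yes x≈0 = x≈0
  ... | no  x≉0 with inverse x x≉0
  ...   | y , xy≈1 = contradiction (begin
    0#             ≈⟨ zeroˡ _ ⟨
    0# * y ^ n     ≈⟨ *-congʳ xⁿ≈0 ⟨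
    x ^ n * y ^ n  ≈⟨ ^-distrib-* x y n ⟨
    (x * y) ^ n    ≈⟨ ^-congˡ n xy≈1 ⟩
    1# ^ n         ≈⟨ 1#^n≈1# n ⟩
    1#             ∎) 0≉1

  -- Translation by 1 permutes F, so Σ x = Σ (x + 1) = Σ x + q.
  q×1≈0 : q × 1# ≈ 0#
  q×1≈0 = begin
    q × 1#                                ≈⟨ trans (sym (×ᵤ≈× q 1#)) (sym (sum-replicate q)) ⟩
    S₁                                    ≈⟨ +-identityˡ _ ⟨
    0# + S₁                               ≈⟨ +-congʳ (-‿inverseˡ S) ⟨
    (- S + S) + S₁                        ≈⟨ +-assoc _ _ _ ⟩
    - S + (S + S₁)                        ≈⟨ +-congˡ (∑-distrib-+ enum (λ _ → 1#)) ⟨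
    - S + sum (λ i → enum i + 1#)         ≈⟨ +-congˡ (sum-cong-≋ {q} (λ i → enum-index (enum i + 1#))) ⟨
    - S + sum (λ i → enum (shift i))      ≈⟨ +-congˡ (sum-permute enum π) ⟨
    - S + S                               ≈⟨ -‿inverseˡ S ⟩
    0#                                    ∎
    where
    S S₁ : Carrier
    S  = sum enum
    S₁ = sum {q} (λ _ → 1#)
    shift unshift : Fin q → Fin q
    shift i   = index (enum i + 1#)
    unshift i = index (enum i - 1#)
    x+1-1≈x : ∀ x → (x + 1#) - 1# ≈ x
    x+1-1≈x x = trans (+-assoc _ _ _) (trans (+-congˡ (-‿inverseʳ 1#)) (+-identityʳ x))
    x-1+1≈x : ∀ x → (x - 1#) + 1# ≈ x
    x-1+1≈x x = trans (+-assoc _ _ _) (trans (+-congˡ (-‿inverseˡ 1#)) (+-identityʳ x))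
    π : Permutation q q
    π = permutation shift unshift
          (λ i → enum-inj _ _ (trans (enum-index _) (trans (+-congʳ (enum-index _)) (x-1+1≈x (enum i)))))
          (λ i → enum-inj _ _ (trans (enum-index _) (trans (+-congʳ (enum-index _)) (x+1-1≈x (enum i)))))

  ×1-homo-^ : ∀ p e → (p ℕ.^ e) × 1# ≈ (p × 1#) ^ e
  ×1-homo-^ p zero    = refl
  ×1-homo-^ p (suc e) = trans (×1-homo-* p (p ℕ.^ e)) (*-congˡ (×1-homo-^ p e))

  characteristic : ∀ p e → q ≡ p ℕ.^ e → p × 1# ≈ 0#
  characteristic p e q≡pᵉ = x^n≈0⇒x≈0 (p × 1#) e
    (trans (sym (×1-homo-^ p e)) (≡.subst (λ n → n × 1# ≈ 0#) q≡pᵉ q×1≈0))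

  n×1≈0⇒[m*n]×1≈0 : ∀ m {n} → n × 1# ≈ 0# → (m ℕ.* n) × 1# ≈ 0#
  n×1≈0⇒[m*n]×1≈0 m {n} n×1≈0 = trans (×1-homo-* m n) (trans (*-congˡ n×1≈0) (zeroʳ _))

  m×1≈0⇒[1+m]×1≉0 : ∀ m → m × 1# ≈ 0# → ¬ (suc m × 1# ≈ 0#)
  m×1≈0⇒[1+m]×1≉0 m m×1≈0 1+m×1≈0 = 0≉1 (begin
    0#             ≈⟨ 1+m×1≈0 ⟨
    suc m × 1#     ≈⟨ 1+× m 1# ⟩
    1# + m × 1#    ≈⟨ +-congˡ m×1≈0 ⟩
    1# + 0#        ≈⟨ +-identityʳ 1# ⟩
    1#             ∎)

  ×1≉0 : ∀ {p j} → Prime p → p × 1# ≈ 0# → 0 < j → j < p → ¬ (j × 1# ≈ 0#)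
  ×1≉0 {p} {j@(suc _)} p-prime char _ j<p j×1≈0 with coprime-Bézout (prime⇒coprime p-prime j<p)
  ... | Bézout.+- a b 1+bj≡ap = m×1≈0⇒[1+m]×1≉0 (b ℕ.* j) (n×1≈0⇒[m*n]×1≈0 b j×1≈0)
                                  (≡.subst (λ n → n × 1# ≈ 0#) (≡.sym 1+bj≡ap) (n×1≈0⇒[m*n]×1≈0 a char))
  ... | Bézout.-+ a b 1+ap≡bj = m×1≈0⇒[1+m]×1≉0 (a ℕ.* p) (n×1≈0⇒[m*n]×1≈0 a char)
                                  (≡.subst (λ n → n × 1# ≈ 0#) (≡.sym 1+ap≡bj) (n×1≈0⇒[m*n]×1≈0 b j×1≈0))

module OverField {c ℓ q} (F : FiniteField c ℓ q) where
  open FiniteField F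
  open IntegerMultiples cring using (_×_)

  module WithParameters {p} (p-prime : Prime p) (e : ℕ) (q≡pᵉ : q ≡ p ℕ.^ e) (t : ℕ) (p≡2t+3 : p ≡ suc (suc (suc (t ℕ.+ t))))
                        (k : ℕ) (1+k<p : suc k < p) (k≢1 : k ≢ 1) where

    open import Relation.Binary.Reasoning.Setoid setoid
    open import Algebra.Properties.Semiring.Exp semiring using (_^_)
    open import Algebra.Properties.Group +-group using (x∙y⁻¹≈ε⇒x≈y)
    open IntegerMultiples cring using (1+×; ×-homo-+; module RingSolver)
    open RingSolver using (solve; _:+_; _:*_; _:-_; _:=_; :0; :1; :4)
    open FiniteFieldProperties F
    open SecondKind cring using (E)
    open RingLemmas cring using (x*[h+h]≈x; *h-cancel)

    char : p × 1# ≈ 0#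
    char = characteristic p e q≡pᵉ

    -- k is the paper's k − 1, so that h = 1/2, K = k − 1 and w = 2 − k in the paper's terms.
    h K w : Carrier
    h = suc (suc t) × 1#
    K = k × 1#
    w = 1# - K

    half : h + h ≈ 1#
    half = begin
      h + h                                         ≈⟨ ×-homo-+ 1# (suc (suc t)) (suc (suc t)) ⟨
      (suc (suc t) ℕ.+ suc (suc t)) × 1#           ≡⟨ ≡.cong (_× 1#) 2t+4≡1+p ⟩
      suc p × 1#                                    ≈⟨ 1+× p 1# ⟩
      1# + p × 1#                                   ≈⟨ +-congˡ char ⟩
      1# + 0#                                       ≈⟨ +-identityʳ 1# ⟩
      1#                                            ∎
      where
      2t+4≡1+p : suc (suc t) ℕ.+ suc (suc t) ≡ suc p
      2t+4≡1+p = ≡.trans (≡.cong (λ n → suc (suc n)) (≡.trans (ℕ.+-suc t (suc t)) (≡.cong suc (ℕ.+-suc t t)))) (≡.cong suc (≡.sym p≡2t+3))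

    w≉0 : ¬ (w ≈ 0#)
    w≉0 w≈0 = 1≉j×1 k ≡.refl (x∙y⁻¹≈ε⇒x≈y 1# K w≈0)
      where
      1≉j×1 : ∀ j → j ≡ k → ¬ (1# ≈ j × 1#)
      1≉j×1 zero          _      1≈0   = 0≉1 (sym 1≈0)
      1≉j×1 (suc zero)    j≡k    _     = k≢1 (≡.sym j≡k)
      1≉j×1 (suc (suc j)) ≡.refl 1≈2+j = ×1≉0 p-prime char (s≤s z≤n) (ℕ.<-trans (ℕ.n<1+n (suc j)) (ℕ.<-trans (ℕ.n<1+n _) 1+k<p))
        (identityʳ-unique 1# _ (sym (trans 1≈2+j (1+× (suc j) 1#))))
        where open import Algebra.Properties.Group +-group using (identityʳ-unique)

    w⁻¹ : Carrier
    w⁻¹ = proj₁ (inverse w w≉0)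

    ww⁻¹≈1 : w * w⁻¹ ≈ 1#
    ww⁻¹≈1 = proj₂ (inverse w w≉0)

    h≈w⁻¹⇒[1+k]×1≈0 : h ≈ w⁻¹ → suc k × 1# ≈ 0#
    h≈w⁻¹⇒[1+k]×1≈0 h≈w⁻¹ = begin
      suc k × 1#                 ≈⟨ 1+× k 1# ⟩
      1# + K                     ≈⟨ solve 2 (λ K w → :1 :+ K := (:1 :+ :1) :- (:1 :- K)) refl K w ⟩
      (1# + 1#) - w              ≈⟨ +-congˡ (-‿cong w≈2) ⟩
      (1# + 1#) - (1# + 1#)      ≈⟨ -‿inverseʳ _ ⟩
      0#                         ∎
      where
      w≈2 : w ≈ 1# + 1#
      w≈2 = begin
        w                          ≈⟨ x*[h+h]≈x half w ⟨
        w * (h + h)                ≈⟨ distribˡ w h h ⟩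
        w * h + w * h              ≈⟨ +-cong (*-congˡ h≈w⁻¹) (*-congˡ h≈w⁻¹) ⟩
        w * w⁻¹ + w * w⁻¹          ≈⟨ +-cong ww⁻¹≈1 ww⁻¹≈1 ⟩
        1# + 1#                    ∎

    D-at-2 : ∀ x → D F 2 (suc k) x ≈ 1# - w * x
    D-at-2 x = begin
      D F 2 (suc k) x                        ≈⟨ D-formula 0 k x ⟩
      (1# - x * 1#) + (K * x) * 1#           ≈⟨ solve 2 (λ x K → (:1 :- x :* :1) :+ (K :* x) :* :1
                                                                := :1 :- (:1 :- K) :* x) refl x K ⟩
      1# - w * x                             ∎

    permutation-at-2 : IsPermutation F (D F 2 (suc k))
    permutation-at-2 = injective , surjective
      where
      solution : ∀ y → 1# - w * (w⁻¹ * (1# - y)) ≈ y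
      solution y = begin
        1# - w * (w⁻¹ * (1# - y))        ≈⟨ +-congˡ (-‿cong (sym (*-assoc w w⁻¹ _))) ⟩
        1# - (w * w⁻¹) * (1# - y)        ≈⟨ +-congˡ (-‿cong (*-congʳ ww⁻¹≈1)) ⟩
        1# - 1# * (1# - y)               ≈⟨ solve 1 (λ y → :1 :- :1 :* (:1 :- y) := y) refl y ⟩
        y                                ∎
      unique : ∀ a → w⁻¹ * (1# - (1# - w * a)) ≈ a
      unique a = begin
        w⁻¹ * (1# - (1# - w * a))        ≈⟨ solve 3 (λ v w a → v :* (:1 :- (:1 :- w :* a)) := (w :* v) :* a) refl w⁻¹ w a ⟩
        (w * w⁻¹) * a                    ≈⟨ *-congʳ ww⁻¹≈1 ⟩
        1# * a                           ≈⟨ *-identityˡ a ⟩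
        a                                ∎
      injective : ∀ a b → D F 2 (suc k) a ≈ D F 2 (suc k) b → a ≈ b
      injective a b Da≈Db = begin
        a                                ≈⟨ unique a ⟨
        w⁻¹ * (1# - (1# - w * a))        ≈⟨ *-congˡ (+-congˡ (-‿cong (trans (sym (D-at-2 a)) (trans Da≈Db (D-at-2 b))))) ⟩
        w⁻¹ * (1# - (1# - w * b))        ≈⟨ unique b ⟩
        b                                ∎
      surjective : ∀ y → ∃ λ x → D F 2 (suc k) x ≈ y
      surjective y = w⁻¹ * (1# - y) , trans (D-at-2 _) (solution y)

    module At (x : Carrier) = SecondKindAtPrimePowers.Evaluated cring p-prime char (suc (suc t)) half x

    module _ (l N : ℕ) (p^l≡2N+3 : p ℕ.^ l ≡ suc (suc (suc (N ℕ.+ N)))) where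

      D-at-p^l : ∀ x → D F (p ℕ.^ l ℕ.+ 1) (suc k) x ≈ h + At.d x ^ suc N * (h - w * x)
      D-at-p^l x = begin
        D F (p ℕ.^ l ℕ.+ 1) (suc k) x                          ≡⟨ ≡.cong (λ n → D F n (suc k) x) p^l+1≡2N+4 ⟩
        D F (suc (suc m)) (suc k) x                            ≈⟨ D-formula m k x ⟩
        E x (suc (suc m)) + (K * x) * E x m                    ≈⟨ +-cong (At.E[p^l+1] x l N p^l≡2N+3) (*-congˡ (At.E[p^l-1] x l N p^l≡2N+3)) ⟩
        (h + dᴺ * (h - x)) + (K * x) * dᴺ                      ≈⟨ solve 4 (λ h x K dᴺ → (h :+ dᴺ :* (h :- x)) :+ (K :* x) :* dᴺ
                                                                                     := h :+ dᴺ :* (h :- (:1 :- K) :* x)) refl h x K dᴺ ⟩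
        h + dᴺ * (h - w * x)                                   ∎
        where
        m : ℕ
        m = suc (suc (N ℕ.+ N))
        dᴺ : Carrier
        dᴺ = At.d x ^ suc N
        p^l+1≡2N+4 : p ℕ.^ l ℕ.+ 1 ≡ suc (suc m)
        p^l+1≡2N+4 = ≡.trans (ℕ.+-comm (p ℕ.^ l) 1) (≡.cong suc p^l≡2N+3)

      d[h*h]≈0 : At.d (h * h) ≈ 0#
      d[h*h]≈0 = begin
        1# - (4 × 1#) * (h * h)      ≈⟨ +-congˡ (-‿cong (solve 1 (λ h → :4 :* (h :* h) := (h :+ h) :* (h :+ h)) refl h)) ⟩
        1# - (h + h) * (h + h)       ≈⟨ +-congˡ (-‿cong (trans (*-cong half half) (*-identityˡ 1#))) ⟩
        1# - 1#                      ≈⟨ -‿inverseʳ 1# ⟩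
        0#                           ∎

      D[h*h]≈h : D F (p ℕ.^ l ℕ.+ 1) (suc k) (h * h) ≈ h
      D[h*h]≈h = begin
        D F (p ℕ.^ l ℕ.+ 1) (suc k) (h * h)                       ≈⟨ D-at-p^l (h * h) ⟩
        h + At.d (h * h) * At.d (h * h) ^ N * (h - w * (h * h))   ≈⟨ +-congˡ (*-congʳ (*-congʳ d[h*h]≈0)) ⟩
        h + 0# * At.d (h * h) ^ N * (h - w * (h * h))             ≈⟨ solve 3 (λ h a b → h :+ :0 :* a :* b := h) refl h _ _ ⟩
        h                                                         ∎

      D[h*w⁻¹]≈h : D F (p ℕ.^ l ℕ.+ 1) (suc k) (h * w⁻¹) ≈ h
      D[h*w⁻¹]≈h = begin
        D F (p ℕ.^ l ℕ.+ 1) (suc k) (h * w⁻¹)         ≈⟨ D-at-p^l (h * w⁻¹) ⟩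
        h + At.d (h * w⁻¹) ^ suc N * (h - w * (h * w⁻¹)) ≈⟨ +-congˡ (*-congˡ (+-congˡ (-‿cong w[hw⁻¹]≈h))) ⟩
        h + At.d (h * w⁻¹) ^ suc N * (h - h)             ≈⟨ solve 2 (λ h a → h :+ a :* (h :- h) := h) refl h _ ⟩
        h                                                ∎
        where
        w[hw⁻¹]≈h : w * (h * w⁻¹) ≈ h
        w[hw⁻¹]≈h = trans (solve 3 (λ w h v → w :* (h :* v) := h :* (w :* v)) refl w h w⁻¹) (trans (*-congˡ ww⁻¹≈1) (*-identityʳ h))

      not-permutation : ¬ IsPermutation F (D F (p ℕ.^ l ℕ.+ 1) (suc k))
      not-permutation (injective , _) = ×1≉0 p-prime char (s≤s z≤n) 1+k<p (h≈w⁻¹⇒[1+k]×1≈0 h≈w⁻¹)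
        where
        h≈w⁻¹ : h ≈ w⁻¹
        h≈w⁻¹ = *h-cancel half (trans (injective _ _ (trans D[h*h]≈h (sym D[h*w⁻¹]≈h))) (*-comm h w⁻¹))

open import Data.Nat using (_^_; _+_)

theorem2p13 : ∀ {c ℓ : Level} (p q e l k : ℕ) → Prime p → p ≢ 2 → 1 ≤ e → q ≡ p ^ e →
              (F : FiniteField c ℓ q) → k ≤ p ∸ 1 → k ≢ 0 → k ≢ 2 →
              IsPermutation F (D F (p ^ l + 1) k) ⇔ (l ≡ 0)
theorem2p13 p q e l zero    _       _   _ _     _ _   k≢0 _   = ⊥-elim (k≢0 ≡.refl)
theorem2p13 p q e l (suc k) p-prime p≢2 _ q≡pᵉ F k≤p-1 _ k≢2 with odd-prime p-prime p≢2
... | t , p≡2t+3 = mk⇔ (to l) (from l)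
  where
  1+k<p : suc k < p
  1+k<p = ℕ.m≤pred[n]⇒suc[m]≤n {{prime⇒nonZero p-prime}} k≤p-1
  k≢1 : k ≢ 1
  k≢1 k≡1 = k≢2 (≡.cong suc k≡1)
  open OverField.WithParameters F p-prime e q≡pᵉ t p≡2t+3 k 1+k<p k≢1
  to : ∀ l → IsPermutation F (D F (p ^ l + 1) (suc k)) → l ≡ 0
  to zero    _ = ≡.refl
  to (suc l) D-permutes with odd-power t p≡2t+3 l
  ... | N , p^[1+l]≡2N+3 = ⊥-elim (not-permutation (suc l) N p^[1+l]≡2N+3 D-permutes)
  from : ∀ l → l ≡ 0 → IsPermutation F (D F (p ^ l + 1) (suc k))
  from .zero ≡.refl = permutation-at-2
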